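{- Let $T'=(V',A')$ be a tournament with weights $w:V'\to\mathbb{Q}_{\ge0}$ such that $\Delta(T')\neq\emptyset$, every vertex of $T'$ lies in some directed triangle of $T'$, and there is an optimal solution $x^*$ of $\mathrm{LP}(T')$ with $x^*_v<\frac37$ for every $v\in V'$. Then $OPT(T')=\frac13 w(V')$.
   Context: A tournament is an orientation of a complete graph. $\Delta(T)$ denotes the family of vertex sets of directed triangles of $T$. $\mathcal{T}_7$ is the family of $7$-vertex tournaments containing no transitive subtournament on $5$ vertices, and $\mathcal{T}_7(T)$ is the family of $7$-element vertex sets $Q$ of $T$ with $T[Q]$ isomorphic to a member of $\mathcal{T}_7$. For a tournament $T$ with vertex weights $w$, $\mathrm{LP}(T)$ is the linear program: minimize $\sum_v w(v)x_v$ subject to $x(R)\ge 1$ for all $R\in\Delta(T)$, $x(Q)\ge 3$ for all $Q\in\mathcal{T}_7(T)$, $x\ge 0$, where $x(R)=\sum_{v\in R}x_v$; $OPT(T)$ denotes its optimum value. $w(V')=\sum_{v\in V'}w(v)$. -}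

module Defs where

open import Data.Nat using (ℕ)
import Data.Nat as ℕ
open import Data.Fin using (Fin; _<_; zero; suc)
open import Data.Bool using (Bool; true; false)
open import Data.Integer using (+_)
open import Data.Rational using (ℚ; 0ℚ; 1ℚ; _+_; _*_; _≤_; _/_)
open import Data.Product using (Σ; ∃; _×_; _,_)
open import Data.Sum using (_⊎_)
open import Function.Definitions using (Injective)
open import Relation.Binary.PropositionalEquality using (_≡_; _≢_)
open import Relation.Nullary using (¬_)

-- Arc relation: arc u v ≡ true means u → v.
record Tournament (n : ℕ) : Set where
  field
    arc        : Fin n → Fin n → Bool
    irrefl     : ∀ u → arc u u ≡ false
    complete   : ∀ u v → u ≢ v → (arc u v ≡ true) ⊎ (arc v u ≡ true)
    antisym    : ∀ u v → arc u v ≡ true → arc v u ≡ false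
open Tournament public

_⇒_within_ : ∀ {n} → Fin n → Fin n → Tournament n → Set
u ⇒ v within T = arc T u v ≡ true

-- (a , b , c) spans a directed triangle a → b → c → a; its vertex set {a,b,c}
-- is a member of Δ(T).
DirTriangle : ∀ {n} → Tournament n → Fin n → Fin n → Fin n → Set
DirTriangle T a b c = (a ⇒ b within T) × (b ⇒ c within T) × (c ⇒ a within T)

sumFin : (n : ℕ) → (Fin n → ℚ) → ℚ
sumFin ℕ.zero    f = 0ℚ
sumFin (ℕ.suc n) f = f zero + sumFin n (λ i → f (suc i))


HasTT5In : ∀ {n} → Tournament n → (Fin 7 → Fin n) → Set
HasTT5In T q = Σ (Fin 5 → Fin 7) λ g → Injective _≡_ _≡_ g ×
  (∀ i j → i < j → q (g i) ⇒ q (g j) within T)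

-- Q = image of q (an injective map Fin 7 → Fin n) is in 𝒯₇(T):
-- T[Q] contains no transitive subtournament on 5 vertices.
InT7 : ∀ {n} → Tournament n → (Fin 7 → Fin n) → Set
InT7 T q = Injective _≡_ _≡_ q × ¬ HasTT5In T q

Feasible : ∀ {n} → Tournament n → (Fin n → ℚ) → Set
Feasible {n} T x =
  (∀ v → 0ℚ ≤ x v) ×
  (∀ a b c → DirTriangle T a b c → 1ℚ ≤ x a + x b + x c) ×
  (∀ q → InT7 T q → (+ 3 / 1) ≤ sumFin 7 (λ i → x (q i)))

objective : ∀ {n} → (Fin n → ℚ) → (Fin n → ℚ) → ℚ
objective {n} w x = sumFin n (λ v → w v * x v)

Optimal : ∀ {n} → Tournament n → (Fin n → ℚ) → (Fin n → ℚ) → Set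
Optimal T w x = Feasible T x × (∀ y → Feasible T y → objective w x ≤ objective w y)

-- If an optimal solution x of LP(T) has all coordinates below 3/7, then
--   (1) no 7-set constraint x(Q) ≥ 3 can hold, since seven values below 3/7
--       sum to less than 3; as x is feasible, 𝒯₇(T) is empty, and
--       feasibility reduces to nonnegativity plus the triangle constraints;
--   (2) the uniform vector 1/3 is then feasible, so OPT ≤ w(V)/3;
--   (3) a vertex on a directed triangle has x_v ≥ 1 − 2·(3/7) = 1/7, so when
--       every vertex is covered the stretched vector y = (3/2)x − 1/6 is
--       nonnegative and satisfies y(R) = (3/2)x(R) − 1/2 ≥ 1 on triangles;
--       optimality gives OPT ≤ (3/2)·OPT − w(V)/6, i.e. OPT ≥ w(V)/3.
-- The file first develops sums over Fin n (monotonicity, linearity) and the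
-- objective of affine images, then the reduction (1), the per-vertex bound,
-- feasibility of the two comparison vectors, and finally the theorem.
module Submission where

open import Defs
open import Data.Nat using (ℕ)
import Data.Nat as ℕ
open import Data.Fin using (Fin)
import Data.Fin as F
open import Data.Integer using (+_)
open import Data.Rational using (ℚ; 0ℚ; 1ℚ; _*_; _+_; -_; _≤_; _<_; _/_)
open import Data.Rational.Properties
open import Data.Rational.Solver using (module +-*-Solver)
open import Data.Product using (Σ; _×_; _,_)
open import Data.Sum using (_⊎_; inj₁; inj₂)
open import Relation.Binary.PropositionalEquality
  using (_≡_; refl; sym; trans; cong; cong₂; subst; subst₂)
open import Relation.Nullary using (¬_; contradiction)
open import Relation.Nullary.Decidable using (toWitness)
open +-*-Solver

sumFin-cong : ∀ n {f g : Fin n → ℚ} → (∀ i → f i ≡ g i) → sumFin n f ≡ sumFin n g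
sumFin-cong ℕ.zero    eq = refl
sumFin-cong (ℕ.suc n) eq = cong₂ _+_ (eq F.zero) (sumFin-cong n (λ i → eq (F.suc i)))

sumFin-mono-≤ : ∀ n {f g : Fin n → ℚ} → (∀ i → f i ≤ g i) → sumFin n f ≤ sumFin n g
sumFin-mono-≤ ℕ.zero    le = ≤-refl
sumFin-mono-≤ (ℕ.suc n) le = +-mono-≤ (le F.zero) (sumFin-mono-≤ n (λ i → le (F.suc i)))

sumFin-mono-< : ∀ n {f g : Fin (ℕ.suc n) → ℚ} → (∀ i → f i < g i) →
  sumFin (ℕ.suc n) f < sumFin (ℕ.suc n) g
sumFin-mono-< n lt = +-mono-<-≤ (lt F.zero) (sumFin-mono-≤ n (λ i → <⇒≤ (lt (F.suc i))))

sumFin-linear : ∀ n (a b : ℚ) (f g : Fin n → ℚ) →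
  sumFin n (λ i → a * f i + b * g i) ≡ a * sumFin n f + b * sumFin n g
sumFin-linear ℕ.zero a b f g =
  solve 2 (λ a b → con 0ℚ := a :* con 0ℚ :+ b :* con 0ℚ) refl a b
sumFin-linear (ℕ.suc n) a b f g = begin
    a * f F.zero + b * g F.zero + sumFin n (λ i → a * f (F.suc i) + b * g (F.suc i))
  ≡⟨ cong (λ s → a * f F.zero + b * g F.zero + s) (sumFin-linear n a b (λ i → f (F.suc i)) (λ i → g (F.suc i))) ⟩
    a * f F.zero + b * g F.zero + (a * F' + b * G')
  ≡⟨ solve 6 (λ a b f₀ g₀ F' G' → a :* f₀ :+ b :* g₀ :+ (a :* F' :+ b :* G')
                                  := a :* (f₀ :+ F') :+ b :* (g₀ :+ G')) refl a b (f F.zero) (g F.zero) F' G' ⟩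
    a * (f F.zero + F') + b * (g F.zero + G')
  ∎
  where
  open Relation.Binary.PropositionalEquality.≡-Reasoning
  F' = sumFin n (λ i → f (F.suc i))
  G' = sumFin n (λ i → g (F.suc i))

objective-affine : ∀ {n} (w x : Fin n → ℚ) (a b : ℚ) →
  objective w (λ v → a * x v + b) ≡ a * objective w x + b * sumFin n w
objective-affine {n} w x a b = trans
  (sumFin-cong n (λ v → solve 4 (λ w x a b → w :* (a :* x :+ b) := a :* (w :* x) :+ b :* w)
                                refl (w v) (x v) a b))
  (sumFin-linear n a b (λ v → w v * x v) w)

objective-const : ∀ {n} (w : Fin n → ℚ) (c : ℚ) → objective w (λ _ → c) ≡ c * sumFin n w
objective-const {n} w c = trans
  (sumFin-cong n (λ v → solve 2 (λ w c → w :* c := con 0ℚ :* w :+ c :* w) refl (w v) c))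
  (trans (sumFin-linear n 0ℚ c w w)
         (solve 2 (λ W c → con 0ℚ :* W :+ c :* W := c :* W) refl (sumFin n w) c))

-- Step (1): a vector with all coordinates below 3/7 violates every 7-set
-- constraint, so if it is feasible then 𝒯₇(T) is empty.
no-T7-below-3/7 : ∀ {n} (T : Tournament n) (x : Fin n → ℚ) →
  Feasible T x → (∀ v → x v < + 3 / 7) → ∀ q → ¬ InT7 T q
no-T7-below-3/7 T x (_ , _ , sevenSets) small q q∈T7 =
  <-irrefl refl (≤-<-trans (sevenSets q q∈T7) (<-≤-trans below sevenTimes3/7))
  where
  below : sumFin 7 (λ i → x (q i)) < sumFin 7 (λ _ → + 3 / 7)
  below = sumFin-mono-< 6 (λ i → small (q i))
  sevenTimes3/7 : sumFin 7 (λ _ → + 3 / 7) ≤ + 3 / 1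
  sevenTimes3/7 = toWitness {a? = sumFin 7 (λ _ → + 3 / 7) ≤? + 3 / 1} _

feasible-without-T7 : ∀ {n} (T : Tournament n) (y : Fin n → ℚ) →
  (∀ q → ¬ InT7 T q) →
  (∀ v → 0ℚ ≤ y v) →
  (∀ a b c → DirTriangle T a b c → 1ℚ ≤ y a + y b + y c) →
  Feasible T y
feasible-without-T7 T y noT7 nonneg triangles =
  nonneg , triangles , (λ q q∈T7 → contradiction q∈T7 (noT7 q))

uniform-feasible : ∀ {n} (T : Tournament n) → (∀ q → ¬ InT7 T q) →
  Feasible T (λ _ → + 1 / 3)
uniform-feasible T noT7 = feasible-without-T7 T _ noT7
  (λ _ → toWitness {a? = 0ℚ ≤? + 1 / 3} _)
  (λ _ _ _ _ → toWitness {a? = 1ℚ ≤? + 1 / 3 + + 1 / 3 + + 1 / 3} _)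

OnTriangle : ∀ {n} → Tournament n → Fin n → Set
OnTriangle {n} T v = Σ (Fin n) λ a → Σ (Fin n) λ b → Σ (Fin n) λ c →
  DirTriangle T a b c × (v ≡ a ⊎ v ≡ b ⊎ v ≡ c)

rotate : ∀ {n} (T : Tournament n) {a b c} → DirTriangle T a b c → DirTriangle T b c a
rotate T (ab , bc , ca) = bc , ca , ab

triangle-from : ∀ {n} (T : Tournament n) v → OnTriangle T v →
  Σ (Fin n) λ b → Σ (Fin n) λ c → DirTriangle T v b c
triangle-from T v (a , b , c , t , inj₁ refl)        = b , c , t
triangle-from T v (a , b , c , t , inj₂ (inj₁ refl)) = c , a , rotate T t
triangle-from T v (a , b , c , t , inj₂ (inj₂ refl)) = a , b , rotate T (rotate T t)

third-above-1/7 : ∀ p q r → 1ℚ ≤ p + q + r → q < + 3 / 7 → r < + 3 / 7 → + 1 / 7 < p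
third-above-1/7 p q r sum≥1 q< r< = begin-strict
    + 1 / 7                                     ≡⟨ refl ⟩
    1ℚ + - (+ 6 / 7)                            ≤⟨ +-monoˡ-≤ (- (+ 6 / 7)) sum≥1 ⟩
    p + q + r + - (+ 6 / 7)                     <⟨ +-monoˡ-< (- (+ 6 / 7)) pairBound ⟩
    p + (+ 3 / 7 + + 3 / 7) + - (+ 6 / 7)       ≡⟨ solve 1 (λ p → p :+ (con (+ 3 / 7) :+ con (+ 3 / 7))
                                                    :+ con (- (+ 6 / 7)) := p) refl p ⟩
    p                                           ∎
  where
  open ≤-Reasoning
  pairBound : p + q + r < p + (+ 3 / 7 + + 3 / 7)
  pairBound = subst (_< p + (+ 3 / 7 + + 3 / 7)) (sym (+-assoc p q r))
                    (+-monoʳ-< p (+-mono-< q< r<))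

coordinate-above-1/7 : ∀ {n} (T : Tournament n) (x : Fin n → ℚ) →
  Feasible T x → (∀ v → x v < + 3 / 7) → (∀ v → OnTriangle T v) → ∀ v → + 1 / 7 < x v
coordinate-above-1/7 T x (_ , triangles , _) small covered v
  with triangle-from T v (covered v)
... | b , c , t = third-above-1/7 (x v) (x b) (x c) (triangles v b c t) (small b) (small c)

stretched-feasible : ∀ {n} (T : Tournament n) (x : Fin n → ℚ) →
  Feasible T x → (∀ v → x v < + 3 / 7) → (∀ v → OnTriangle T v) →
  Feasible T (λ v → + 3 / 2 * x v + - (+ 1 / 6))
stretched-feasible T x feas@(_ , triangles , _) small covered =
  feasible-without-T7 T _ (no-T7-below-3/7 T x feas small) nonneg triangle
  where
  nonneg : ∀ v → 0ℚ ≤ + 3 / 2 * x v + - (+ 1 / 6)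
  nonneg v = ≤-trans (toWitness {a? = 0ℚ ≤? + 3 / 2 * (+ 1 / 7) + - (+ 1 / 6)} _)
    (+-monoˡ-≤ (- (+ 1 / 6)) (*-monoˡ-≤-nonNeg (+ 3 / 2)
      (<⇒≤ (coordinate-above-1/7 T x feas small covered v))))
  triangle : ∀ a b c → DirTriangle T a b c →
    1ℚ ≤ + 3 / 2 * x a + - (+ 1 / 6) + (+ 3 / 2 * x b + - (+ 1 / 6)) + (+ 3 / 2 * x c + - (+ 1 / 6))
  triangle a b c t = subst (1ℚ ≤_) regroup
    (≤-trans (toWitness {a? = 1ℚ ≤? + 3 / 2 * 1ℚ + - (+ 1 / 2)} _)
             (+-monoˡ-≤ (- (+ 1 / 2)) (*-monoˡ-≤-nonNeg (+ 3 / 2) (triangles a b c t))))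
    where
    regroup : + 3 / 2 * (x a + x b + x c) + - (+ 1 / 2) ≡
              + 3 / 2 * x a + - (+ 1 / 6) + (+ 3 / 2 * x b + - (+ 1 / 6)) + (+ 3 / 2 * x c + - (+ 1 / 6))
    regroup = solve 3 (λ p q r →
      con (+ 3 / 2) :* (p :+ q :+ r) :+ con (- (+ 1 / 2)) :=
      con (+ 3 / 2) :* p :+ con (- (+ 1 / 6)) :+ (con (+ 3 / 2) :* q :+ con (- (+ 1 / 6)))
        :+ (con (+ 3 / 2) :* r :+ con (- (+ 1 / 6)))) refl (x a) (x b) (x c)

third-below-of-stretch : ∀ P W → P ≤ + 3 / 2 * P + - (+ 1 / 6) * W → + 1 / 3 * W ≤ P
third-below-of-stretch P W le = subst₂ _≤_ lhs rhs
  (*-monoˡ-≤-nonNeg (+ 2 / 1) (+-monoˡ-≤ (+ 1 / 6 * W + - 1ℚ * P) le))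
  where
  lhs : + 2 / 1 * (P + (+ 1 / 6 * W + - 1ℚ * P)) ≡ + 1 / 3 * W
  lhs = solve 2 (λ P W → con (+ 2 / 1) :* (P :+ (con (+ 1 / 6) :* W :+ con (- 1ℚ) :* P))
                         := con (+ 1 / 3) :* W) refl P W
  rhs : + 2 / 1 * (+ 3 / 2 * P + - (+ 1 / 6) * W + (+ 1 / 6 * W + - 1ℚ * P)) ≡ P
  rhs = solve 2 (λ P W → con (+ 2 / 1) :* (con (+ 3 / 2) :* P :+ con (- (+ 1 / 6)) :* W
                         :+ (con (+ 1 / 6) :* W :+ con (- 1ℚ) :* P)) := P) refl P W

-- OPT(T) = w(V)/3.
lemma2 : (n : ℕ) (T : Tournament n) (w : Fin n → ℚ) →
    (∀ v → 0ℚ ≤ w v) →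
    (Σ (Fin n) λ a → Σ (Fin n) λ b → Σ (Fin n) λ c → DirTriangle T a b c) →
    (∀ v → Σ (Fin n) λ a → Σ (Fin n) λ b → Σ (Fin n) λ c →
    DirTriangle T a b c × (v ≡ a ⊎ v ≡ b ⊎ v ≡ c)) →
    (xs : Fin n → ℚ) → Optimal T w xs → (∀ v → xs v < + 3 / 7) →
    objective w xs ≡ (+ 1 / 3) * sumFin n w
lemma2 n T w _ _ covered xs (feasible , optimal) small = ≤-antisym upper lower
  where
  upper : objective w xs ≤ + 1 / 3 * sumFin n w
  upper = subst (objective w xs ≤_) (objective-const w (+ 1 / 3))
    (optimal _ (uniform-feasible T (no-T7-below-3/7 T xs feasible small)))
  lower : + 1 / 3 * sumFin n w ≤ objective w xs
  lower = third-below-of-stretch (objective w xs) (sumFin n w)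
    (subst (objective w xs ≤_) (objective-affine w xs (+ 3 / 2) (- (+ 1 / 6)))
      (optimal _ (stretched-feasible T xs feasible small covered)))
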